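{- Let $k\geq 2$ and $n$ be positive integers and let $\mathcal{F}\subset 2^{[n]}$ be a $k$-cross-free family. Then there exists a weakly $k$-cross-free family $\mathcal{F}'\subset 2^{[n]}$ such that $|\mathcal{F}'|\geq |\mathcal{F}|/2$.
   Context: $[n]=\{1,\ldots,n\}$ and $2^{[n]}$ is the family of all subsets of $[n]$. Two sets $A,B\subset[n]$ are crossing if $A\setminus B$, $B\setminus A$, $A\cap B$ and $[n]\setminus(A\cup B)$ are all non-empty; they are weakly crossing if $A\setminus B$, $B\setminus A$ and $A\cap B$ are all non-empty. A family is $k$-cross-free if it does not contain $k$ pairwise crossing sets, and weakly $k$-cross-free if it does not contain $k$ pairwise weakly crossing sets. -}

module Defs where

open import Data.Nat using (ℕ)
open import Data.Fin using (Fin)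
open import Data.Fin.Subset using (Subset; Nonempty; _∩_; _∪_; _─_; ∁)
open import Data.List using (List)
open import Data.List.Membership.Propositional using (_∈_)
open import Data.Product using (Σ; _×_)
open import Relation.Binary.PropositionalEquality using (_≢_)
open import Relation.Nullary using (¬_)

-- A family of subsets of [n] is a list of distinct elements of Subset n
-- (distinctness imposed separately via Unique); its size is the list length.

Crossing : ∀ {n} → Subset n → Subset n → Set
Crossing A B = Nonempty (A ─ B) × Nonempty (B ─ A) × Nonempty (A ∩ B) × Nonempty (∁ (A ∪ B))

WeaklyCrossing : ∀ {n} → Subset n → Subset n → Set
WeaklyCrossing A B = Nonempty (A ─ B) × Nonempty (B ─ A) × Nonempty (A ∩ B)

ContainsPairwise : ∀ {n} → (Subset n → Subset n → Set) → ℕ → List (Subset n) → Set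
ContainsPairwise R k F =
  Σ (Fin k → Subset _) λ g → ((i : Fin k) → g i ∈ F) × ((i j : Fin k) → i ≢ j → R (g i) (g j))

KCrossFree : ∀ {n} → ℕ → List (Subset n) → Set
KCrossFree k F = ¬ ContainsPairwise Crossing k F

WeaklyKCrossFree : ∀ {n} → ℕ → List (Subset n) → Set
WeaklyKCrossFree k F = ¬ ContainsPairwise WeaklyCrossing k F

module Submission where

-- Fix a point x of [n] (here n ≥ 1, so x = 0 exists).  Split F into the sets
-- avoiding x, and the complements of the sets containing x.  Both parts
-- consist of sets avoiding x, and two sets avoiding a common point cross as
-- soon as they weakly cross (x witnesses [n] ∖ (A ∪ B) ≠ ∅).  Moreover, the
-- crossing relation is invariant under complementing either set, so a
-- pairwise weakly crossing k-tuple in either part yields a pairwise crossing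
-- k-tuple in F itself.  Hence both parts are weakly k-cross-free, both are
-- duplicate-free (complementation is injective), and their sizes add up to
-- |F|, so the larger one has at least |F|/2 members.

open import Defs
open import Data.Nat using (ℕ; suc; _+_; _*_; _≤_)
open import Data.Nat.Properties using (≤-total; +-monoʳ-≤; +-monoˡ-≤; +-identityʳ; +-suc; +-comm)
open import Data.Fin using (Fin) renaming (zero to fzero)
open import Data.Fin.Subset using (Subset; _∪_; _─_; ∁; _∈_; _∉_; inside; outside)
open import Data.Fin.Subset.Properties
  using ( _∈?_; x∈p∩q⁺; x∈p∩q⁻; x∈p∪q⁻; x∈p∪q⁺; x∈p∧x∉q⇒x∈p─q; p─q⊆p; ∩-comm; ∪-comm
        ; x∈∁p⇒x∉p; x∉p⇒x∈∁p; x∈p⇒x∉∁p; ∪-∩-booleanAlgebra )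
import Algebra.Lattice.Properties.BooleanAlgebra as BooleanAlgebraProperties
open import Data.Vec using (_∷_; here; there)
open import Data.List using (List; []; _∷_; length; map; filter)
open import Data.List.Properties using (length-map)
open import Data.List.Membership.Propositional using () renaming (_∈_ to _∈ₗ_)
open import Data.List.Membership.Propositional.Properties using (∈-map⁻; ∈-filter⁻)
open import Data.List.Relation.Unary.Unique.Propositional using (Unique)
import Data.List.Relation.Unary.Unique.Propositional.Properties as Unique
open import Data.Product using (Σ; _×_; _,_; proj₁; proj₂)
open import Data.Sum using (_⊎_; inj₁; inj₂; [_,_])
open import Function using (_∘_; id)
open import Relation.Binary.PropositionalEquality using (_≡_; _≢_; refl; sym; trans; cong; subst; module ≡-Reasoning)
open import Relation.Nullary using (¬?; yes; no)
open import Relation.Unary using (Pred; Decidable)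

variable
  n : ℕ
  x : Fin n
  A B : Subset n

x∈p─q⇒x∉q : x ∈ A ─ B → x ∉ B
x∈p─q⇒x∉q {A = _ ∷ _} {B = inside  ∷ _} ()       here
x∈p─q⇒x∉q {A = _ ∷ _} {B = outside ∷ _} (there h) (there g) = x∈p─q⇒x∉q h g
x∈p─q⇒x∉q {A = _ ∷ _} {B = inside  ∷ _} (there h) (there g) = x∈p─q⇒x∉q h g

∉-∪⇒∈∁ : x ∉ A → x ∉ B → x ∈ ∁ (A ∪ B)
∉-∪⇒∈∁ {A = A} {B = B} x∉A x∉B = x∉p⇒x∈∁p ([ x∉A , x∉B ] ∘ x∈p∪q⁻ A B)

∈∁∪⇒∉ : x ∈ ∁ (A ∪ B) → x ∉ A × x ∉ B
∈∁∪⇒∉ {A = A} {B = B} h = (λ x∈A → x∈∁p⇒x∉p h (x∈p∪q⁺ (inj₁ x∈A)))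
                         , (λ x∈B → x∈∁p⇒x∉p h (x∈p∪q⁺ (inj₂ x∈B)))

crossing-sym : Crossing A B → Crossing B A
crossing-sym {A = A} {B = B} (a─b , b─a , (x , x∈A∩B) , (y , y∈∁A∪B)) =
  b─a , a─b , (x , subst (x ∈_) (∩-comm A B) x∈A∩B) , (y , subst (λ C → y ∈ ∁ C) (∪-comm A B) y∈∁A∪B)

-- Complementing one set permutes the four regions of a crossing pair:
-- ∁A ∖ B = ∁(A ∪ B), B ∖ ∁A = A ∩ B, ∁A ∩ B = B ∖ A, ∁(∁A ∪ B) = A ∖ B.
crossing-∁ˡ : Crossing A B → Crossing (∁ A) B
crossing-∁ˡ {A = A} {B = B} ((x₁ , h₁) , (x₂ , h₂) , (x₃ , h₃) , (x₄ , h₄)) =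
    (x₄ , x∈p∧x∉q⇒x∈p─q (x∉p⇒x∈∁p (proj₁ (∈∁∪⇒∉ h₄))) (proj₂ (∈∁∪⇒∉ h₄)))
  , (x₃ , x∈p∧x∉q⇒x∈p─q (proj₂ (x∈p∩q⁻ A B h₃)) (x∈p⇒x∉∁p (proj₁ (x∈p∩q⁻ A B h₃))))
  , (x₂ , x∈p∩q⁺ (x∉p⇒x∈∁p (x∈p─q⇒x∉q h₂) , p─q⊆p B A h₂))
  , (x₁ , ∉-∪⇒∈∁ (x∈p⇒x∉∁p (p─q⊆p A B h₁)) (x∈p─q⇒x∉q h₁))

crossing-∁ʳ : Crossing A B → Crossing A (∁ B)
crossing-∁ʳ = crossing-sym ∘ crossing-∁ˡ ∘ crossing-sym

weaklyCrossing⇒crossing : x ∉ A → x ∉ B → WeaklyCrossing A B → Crossing A B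
weaklyCrossing⇒crossing {x = x} x∉A x∉B (a─b , b─a , a∩b) = a─b , b─a , a∩b , (x , ∉-∪⇒∈∁ x∉A x∉B)

_∈ᶜ_ : Subset n → List (Subset n) → Set
B ∈ᶜ F = B ∈ₗ F ⊎ ∁ B ∈ₗ F

representative : {F : List (Subset n)} → B ∈ᶜ F → Subset n
representative {B = B} (inj₁ _) = B
representative {B = B} (inj₂ _) = ∁ B

representative-∈ : {F : List (Subset n)} (m : B ∈ᶜ F) → representative m ∈ₗ F
representative-∈ (inj₁ B∈F)  = B∈F
representative-∈ (inj₂ ∁B∈F) = ∁B∈F

crossing-representative : {F : List (Subset n)} (mA : A ∈ᶜ F) (mB : B ∈ᶜ F) →
  Crossing A B → Crossing (representative mA) (representative mB)
crossing-representative (inj₁ _) (inj₁ _) = id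
crossing-representative (inj₂ _) (inj₁ _) = crossing-∁ˡ
crossing-representative (inj₁ _) (inj₂ _) = crossing-∁ʳ
crossing-representative (inj₂ _) (inj₂ _) = crossing-∁ˡ ∘ crossing-∁ʳ

weaklyCrossFree-transfer : (k : ℕ) (x : Fin n) {F G : List (Subset n)} →
  (∀ {B} → B ∈ₗ G → x ∉ B × B ∈ᶜ F) → KCrossFree k F → WeaklyKCrossFree k G
weaklyCrossFree-transfer k x {F} represented crossFree (g , g∈G , weaklyCrossing) =
  crossFree (representative ∘ m , representative-∈ ∘ m , crossing)
  where
    m : (i : Fin k) → g i ∈ᶜ F
    m i = proj₂ (represented (g∈G i))

    crossing : (i j : Fin k) → i ≢ j → Crossing (representative (m i)) (representative (m j))
    crossing i j i≢j = crossing-representative (m i) (m j)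
      (weaklyCrossing⇒crossing (proj₁ (represented (g∈G i))) (proj₁ (represented (g∈G j)))
        (weaklyCrossing i j i≢j))

∁-involutive : ∀ (A : Subset n) → ∁ (∁ A) ≡ A
∁-involutive {n} = BooleanAlgebraProperties.¬-involutive (∪-∩-booleanAlgebra n)

∁-injective : ∁ A ≡ ∁ B → A ≡ B
∁-injective {A = A} {B = B} ∁A≡∁B = begin
  A         ≡⟨ sym (∁-involutive A) ⟩
  ∁ (∁ A)   ≡⟨ cong ∁ ∁A≡∁B ⟩
  ∁ (∁ B)   ≡⟨ ∁-involutive B ⟩
  B         ∎
  where open ≡-Reasoning

length-filter-split : ∀ {a p} {X : Set a} {P : Pred X p} (P? : Decidable P) (xs : List X) →
  length (filter P? xs) + length (filter (¬? ∘ P?) xs) ≡ length xs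
length-filter-split P? [] = refl
length-filter-split P? (y ∷ ys) with P? y
... | yes _ = cong suc (length-filter-split P? ys)
... | no  _ = trans (+-suc _ _) (cong suc (length-filter-split P? ys))

module Halves (x : Fin n) (F : List (Subset n)) where

  containsx? : Decidable (x ∈_)
  containsx? A = x ∈? A

  avoiding : List (Subset n)
  avoiding = filter (¬? ∘ containsx?) F

  complemented : List (Subset n)
  complemented = map ∁ (filter containsx? F)

  length-halves : length avoiding + length complemented ≡ length F
  length-halves = begin
    length avoiding + length complemented
      ≡⟨ cong (length avoiding +_) (length-map ∁ (filter containsx? F)) ⟩
    length avoiding + length (filter containsx? F)
      ≡⟨ +-comm (length avoiding) _ ⟩
    length (filter containsx? F) + length avoiding
      ≡⟨ length-filter-split containsx? F ⟩
    length F
      ∎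
    where open ≡-Reasoning

  unique-avoiding : Unique F → Unique avoiding
  unique-avoiding = Unique.filter⁺ (¬? ∘ containsx?)

  unique-complemented : Unique F → Unique complemented
  unique-complemented = Unique.map⁺ ∁-injective ∘ Unique.filter⁺ containsx?

  avoiding-represented : B ∈ₗ avoiding → x ∉ B × B ∈ᶜ F
  avoiding-represented B∈ with ∈-filter⁻ (¬? ∘ containsx?) B∈
  ... | B∈F , x∉B = x∉B , inj₁ B∈F

  complemented-represented : B ∈ₗ complemented → x ∉ B × B ∈ᶜ F
  complemented-represented B∈ with ∈-map⁻ ∁ B∈
  ... | A , A∈ , refl with ∈-filter⁻ containsx? A∈
  ...   | A∈F , x∈A = x∈p⇒x∉∁p x∈A , inj₂ (subst (_∈ₗ F) (sym (∁-involutive A)) A∈F)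

larger-half : ∀ a b → a + b ≤ 2 * a ⊎ a + b ≤ 2 * b
larger-half a b with ≤-total b a
... | inj₁ b≤a = inj₁ (subst (a + b ≤_) (cong (a +_) (sym (+-identityʳ a))) (+-monoʳ-≤ a b≤a))
... | inj₂ a≤b = inj₂ (subst (a + b ≤_) (cong (b +_) (sym (+-identityʳ b))) (+-monoˡ-≤ b a≤b))

HalfWeaklyCrossFree : ℕ → List (Subset n) → Set
HalfWeaklyCrossFree {n} k F =
  Σ (List (Subset n)) λ F′ → Unique F′ × WeaklyKCrossFree k F′ × (length F ≤ 2 * length F′)

halving : (k : ℕ) (x : Fin n) (F : List (Subset n)) → Unique F → KCrossFree k F →
  HalfWeaklyCrossFree k F
halving k x F unique crossFree = keepLarger (larger-half (length avoiding) (length complemented))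
  where
    open Halves x F

    keepLarger : length avoiding + length complemented ≤ 2 * length avoiding
               ⊎ length avoiding + length complemented ≤ 2 * length complemented →
               HalfWeaklyCrossFree k F
    keepLarger (inj₁ half) =
      avoiding , unique-avoiding unique ,
      weaklyCrossFree-transfer k x avoiding-represented crossFree ,
      subst (_≤ 2 * length avoiding) length-halves half
    keepLarger (inj₂ half) =
      complemented , unique-complemented unique ,
      weaklyCrossFree-transfer k x complemented-represented crossFree ,
      subst (_≤ 2 * length complemented) length-halves half

-- The theorem: [n] is nonempty, so halve F with respect to the point 0.
lemma4 : (k n : ℕ) → 2 ≤ k → 1 ≤ n → (F : List (Subset n)) → Unique F → KCrossFree k F →
    Σ (List (Subset n)) λ F′ → Unique F′ × WeaklyKCrossFree k F′ × (length F ≤ 2 * length F′)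
lemma4 k (suc m) _ _ F = halving k fzero F
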